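{- Let $m,n$ be positive integers and let $K_{m\times n}$ be the $m\times n$ king graph. Let $P_{m\times n}(z)$ be the domination polynomial of $K_{m\times n}$. Then \[ P_{m\times n}(-1) = (-1)^{\lceil m/2\rceil \lceil n/2\rceil}. \]
   Context: The $m\times n$ king graph $K_{m\times n}=(V,E)$ has vertex set $V=[m]\times[n]$, where $[k]=\{1,\dots,k\}$, and $((x,y),(x',y'))\in E$ if and only if $\max(|x-x'|,|y-y'|)=1$. A dominating set of a graph $G=(V,E)$ is a subset $S\subseteq V$ such that every vertex of $V$ is in $S$ or has a neighbor in $S$. The domination polynomial of $G$ is $P_G(z)=\sum_{S\subseteq V,\ S \text{ dominating}} z^{|S|}=\sum_{k=0}^{|V|} N_k z^k$, where $N_k$ is the number of dominating sets of size $k$. -}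

module Defs where

open import Data.Nat as ℕ using (ℕ; zero; suc; _*_; _⊔_; _∸_)
open import Data.Nat.Properties using (_≟_)
open import Data.Fin using (Fin; toℕ)
open import Data.Bool using (Bool; true; false; if_then_else_; _∨_; _∧_)
open import Data.Product using (_×_; _,_)
open import Data.List using (List; []; _∷_; map; filter; length; allFin; cartesianProduct; concatMap; upTo; foldr)
open import Data.Bool.ListAction using (any; all)
open import Data.Integer as ℤ using (ℤ; +_)
open import Relation.Nullary.Decidable using (⌊_⌋)

Vertex : ℕ → ℕ → Set
Vertex m n = Fin m × Fin n

vertices : (m n : ℕ) → List (Vertex m n)
vertices m n = cartesianProduct (allFin m) (allFin n)

dist : ℕ → ℕ → ℕ
dist a b = (a ∸ b) ⊔ (b ∸ a)

adjacent : {m n : ℕ} → Vertex m n → Vertex m n → Bool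
adjacent (x , y) (x' , y') = ⌊ dist (toℕ x) (toℕ x') ⊔ dist (toℕ y) (toℕ y') ≟ 1 ⌋

Subset : ℕ → ℕ → Set
Subset m n = Vertex m n → Bool

sublists : {A : Set} → List A → List (List A)
sublists [] = [] ∷ []
sublists (a ∷ as) = let r = sublists as in map (a ∷_) r Data.List.++ r

dominates : {m n : ℕ} → List (Vertex m n) → Vertex m n → Bool
dominates S v = any (λ s → ⌊ toℕ (Data.Product.proj₁ s) ≟ toℕ (Data.Product.proj₁ v) ⌋
                          ∧ ⌊ toℕ (Data.Product.proj₂ s) ≟ toℕ (Data.Product.proj₂ v) ⌋
                          ∨ adjacent s v) S

isDominating : (m n : ℕ) → List (Vertex m n) → Bool
isDominating m n S = all (dominates S) (vertices m n)

-- All dominating sets (each subset of V listed exactly once, as a sublist of the vertex list).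
dominatingSets : (m n : ℕ) → List (List (Vertex m n))
dominatingSets m n = filter (λ S → Data.Bool._≟_ (isDominating m n S) true) (sublists (vertices m n))

N : (m n k : ℕ) → ℕ
N m n k = length (filter (λ S → length S ≟ k) (dominatingSets m n))

dominationPoly : (m n : ℕ) → ℤ → ℤ
dominationPoly m n z = foldr (λ k acc → (+ N m n k) ℤ.* (z ℤ.^ k) ℤ.+ acc) (+ 0) (upTo (suc (m * n)))

-- Expand P(−1) = Σ_S (−1)^|S| [S dominating] by deciding one candidate vertex a at a time:
-- the sum over candidate set L ∪ {a} is the sum over L minus the sum over L in which the
-- closed neighbourhood N[a] counts as already covered.  If N[a] ⊆ N[b] and a is still a
-- candidate, then b can be dropped from the candidates.  In a grid of rows k, k+1, k+2, …
-- every vertex (k+1, y) dominates (k, y), so row k+1 disappears as candidates; afterwards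
-- covering row k forces covering row k+1, so row k+1 disappears as targets as well, and the
-- grid splits into row k and the grid from row k+2.  Hence the sum for P_m ⊠ G is the sum
-- for G raised to ⌈m/2⌉; for G a single vertex this gives (−1)^⌈n/2⌉ for the path P_n, and
-- for G = P_n it gives the theorem.
module Submission where

open import Defs
open import Data.Nat using (ℕ; suc; _≤_; _*_; ⌈_/2⌉)
open import Data.Integer using (ℤ; -_; +_; _^_)
open import Relation.Binary.PropositionalEquality using (_≡_)

open import Data.Bool as Bool using (Bool; true; false; T; _∧_; _∨_)
import Data.Bool.Properties as BoolP
open import Data.Bool.ListAction using (and; all; any)
open import Data.Empty using (⊥-elim)
open import Data.Fin as Fin using (Fin; toℕ)
open import Data.Integer using (0ℤ; 1ℤ; -1ℤ; _+_; _-_)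
import Data.Integer as ℤ
import Data.Integer.Properties as ℤP
open import Data.Integer.Tactic.RingSolver using (solve-∀)
open import Data.List
  using (List; []; _∷_; _++_; map; foldr; length; filter; tabulate; allFin; upTo; cartesianProduct)
import Data.List.Properties as ListP
open import Data.List.Membership.Propositional using (_∈_)
open import Data.List.Membership.Propositional.Properties using (∈-upTo⁺)
open import Data.List.Relation.Binary.Permutation.Propositional as ↭ using (_↭_)
open import Data.List.Relation.Binary.Permutation.Propositional.Properties using (shift)
open import Data.List.Relation.Unary.All as All using (All; []; _∷_)
open import Data.List.Relation.Unary.All.Properties using (++⁺; map⁺; filter⁺; cartesianProduct⁺)
open import Data.List.Relation.Unary.Any using (here; there)
open import Data.List.Relation.Unary.Unique.Propositional using (Unique)
open import Data.List.Relation.Unary.Unique.Propositional.Properties using (upTo⁺)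
open import Data.List.Relation.Unary.AllPairs using (_∷_)
open import Data.Nat as ℕ using (zero; _≤ᵇ_; _⊔_; z≤n; s≤s)
import Data.Nat.Properties as ℕP
open import Data.Product using (_×_; _,_; proj₁; proj₂; map₁)
import Data.Sum as Sum
open import Data.Unit using (⊤; tt)
open import Function using (_∘_; Equivalence)
open import Relation.Binary.PropositionalEquality
  using (_≢_; refl; sym; trans; cong; cong₂; subst; setoid; module ≡-Reasoning)
open import Relation.Nullary using (does)
open import Relation.Nullary.Decidable using (⌊_⌋; isYes≗does; dec-true; dec-false)
open import Relation.Unary using (Decidable)

open Equivalence using (to; from)

𝟙 : Bool → ℤ
𝟙 true = 1ℤ
𝟙 false = 0ℤ

𝟙-∧ : ∀ x y → 𝟙 (x ∧ y) ≡ 𝟙 x ℤ.* 𝟙 y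
𝟙-∧ true y = sym (ℤP.*-identityˡ (𝟙 y))
𝟙-∧ false y = refl

all-++ : {U : Set} (c : U → Bool) (xs ys : List U) → all c (xs ++ ys) ≡ all c xs ∧ all c ys
all-++ c [] ys = refl
all-++ c (x ∷ xs) ys = trans (cong (c x ∧_) (all-++ c xs ys)) (sym (BoolP.∧-assoc (c x) _ _))

all-cong : {U : Set} {c c' : U → Bool} {Us : List U} →
  All (λ u → c u ≡ c' u) Us → all c Us ≡ all c' Us
all-cong eqs = cong and (ListP.map-cong-local eqs)

T-∧-monoˡ : ∀ {a b} c → (T a → T b) → T (a ∧ c) → T (b ∧ c)
T-∧-monoˡ c a⇒b t = from BoolP.T-∧ (a⇒b (proj₁ (to BoolP.T-∧ t)) , proj₂ (to BoolP.T-∧ t))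

T-∨-mono : ∀ {a b c d} → (T a → T b) → (T c → T d) → T (a ∨ c) → T (b ∨ d)
T-∨-mono a⇒b c⇒d t = from BoolP.T-∨ (Sum.map a⇒b c⇒d (to BoolP.T-∨ t))

∧-absorbˡ : ∀ a {b} c → (T a → T b) → a ∧ (b ∧ c) ≡ a ∧ c
∧-absorbˡ false c a⇒b = refl
∧-absorbˡ true {true} c a⇒b = refl
∧-absorbˡ true {false} c a⇒b = ⊥-elim (a⇒b _)

∑ : {X : Set} → List X → (X → ℤ) → ℤ
∑ xs f = foldr (λ x acc → f x + acc) 0ℤ xs

module _ {X : Set} where

  ∑-cong : ∀ xs {f g : X → ℤ} → (∀ x → f x ≡ g x) → ∑ xs f ≡ ∑ xs g
  ∑-cong [] eq = refl
  ∑-cong (x ∷ xs) eq = cong₂ _+_ (eq x) (∑-cong xs eq)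

  ∑-++ : ∀ xs ys (f : X → ℤ) → ∑ (xs ++ ys) f ≡ ∑ xs f + ∑ ys f
  ∑-++ [] ys f = sym (ℤP.+-identityˡ _)
  ∑-++ (x ∷ xs) ys f = trans (cong (λ t → f x + t) (∑-++ xs ys f)) (sym (ℤP.+-assoc (f x) _ _))

  ∑-map : {Y : Set} (g : Y → X) → ∀ ys (f : X → ℤ) → ∑ (map g ys) f ≡ ∑ ys (f ∘ g)
  ∑-map g [] f = refl
  ∑-map g (y ∷ ys) f = cong (λ t → f (g y) + t) (∑-map g ys f)

  ∑-neg : ∀ xs (f : X → ℤ) → ∑ xs (λ x → - f x) ≡ - ∑ xs f
  ∑-neg [] f = refl
  ∑-neg (x ∷ xs) f = trans (cong (λ t → - f x + t) (∑-neg xs f)) (sym (ℤP.neg-distrib-+ (f x) _))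

  ∑-+ : ∀ xs (f g : X → ℤ) → ∑ xs (λ x → f x + g x) ≡ ∑ xs f + ∑ xs g
  ∑-+ [] f g = refl
  ∑-+ (x ∷ xs) f g = trans (cong (λ t → f x + g x + t) (∑-+ xs f g)) (shuffle (f x) (g x) _ _)
    where
    shuffle : ∀ a b c d → a + b + (c + d) ≡ (a + c) + (b + d)
    shuffle = solve-∀

  ∑-zero : ∀ xs → ∑ xs (λ (_ : X) → 0ℤ) ≡ 0ℤ
  ∑-zero [] = refl
  ∑-zero (x ∷ xs) = trans (ℤP.+-identityˡ _) (∑-zero xs)

  ∑-filter : {P : X → Set} (P? : Decidable P) → ∀ xs (f : X → ℤ) →
    ∑ (filter P? xs) f ≡ ∑ xs (λ x → f x ℤ.* 𝟙 (does (P? x)))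
  ∑-filter P? [] f = refl
  ∑-filter P? (x ∷ xs) f with does (P? x)
  ... | true = cong₂ _+_ (sym (ℤP.*-identityʳ (f x))) (∑-filter P? xs f)
  ... | false = trans (∑-filter P? xs f)
                      (sym (trans (cong (_+ _) (ℤP.*-zeroʳ (f x))) (ℤP.+-identityˡ _)))

  +length-filter-∷ : {P : X → Set} (P? : Decidable P) → ∀ x xs →
    + length (filter P? (x ∷ xs)) ≡ 𝟙 (does (P? x)) + + length (filter P? xs)
  +length-filter-∷ P? x xs with does (P? x)
  ... | true = refl
  ... | false = refl

module _ (l : ℕ) (f : ℕ → ℤ) where

  δ : ℕ → ℤ
  δ k = 𝟙 (does (l ℕ.≟ k)) ℤ.* f k

  ∑-δ-skip : ∀ {k} ks → l ≢ k → ∑ (k ∷ ks) δ ≡ ∑ ks δ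
  ∑-δ-skip {k} ks l≢k =
    trans (cong (λ b → 𝟙 b ℤ.* f k + ∑ ks δ) (dec-false (l ℕ.≟ k) l≢k)) (ℤP.+-identityˡ (∑ ks δ))

  ∑-δ-∉ : ∀ ks → All (l ≢_) ks → ∑ ks δ ≡ 0ℤ
  ∑-δ-∉ [] [] = refl
  ∑-δ-∉ (k ∷ ks) (l≢k ∷ l∉ks) = trans (∑-δ-skip ks l≢k) (∑-δ-∉ ks l∉ks)

  ∑-δ : ∀ ks → Unique ks → l ∈ ks → ∑ ks δ ≡ f l
  ∑-δ (_ ∷ ks) (l∉ks ∷ _) (here refl) = begin
      𝟙 (does (l ℕ.≟ l)) ℤ.* f l + ∑ ks δ  ≡⟨ cong (λ b → 𝟙 b ℤ.* f l + ∑ ks δ) (dec-true (l ℕ.≟ l) refl) ⟩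
      1ℤ ℤ.* f l + ∑ ks δ                  ≡⟨ cong₂ _+_ (ℤP.*-identityˡ (f l)) (∑-δ-∉ ks l∉ks) ⟩
      f l + 0ℤ                             ≡⟨ ℤP.+-identityʳ (f l) ⟩
      f l                                  ∎
    where open ≡-Reasoning
  ∑-δ (k ∷ ks) (k∉ks ∷ uniq) (there l∈ks) =
    trans (∑-δ-skip ks (λ l≡k → All.lookup k∉ks l∈ks (sym l≡k))) (∑-δ ks uniq l∈ks)

sizeCount : {X : Set} → List (List X) → ℕ → ℕ
sizeCount D k = length (filter (λ S → length S ℕ.≟ k) D)

∑-sizeCount : {X : Set} (z : ℤ) (K : ℕ) (D : List (List X)) → All (λ S → length S ≤ K) D →
  ∑ (upTo (suc K)) (λ k → + sizeCount D k ℤ.* z ^ k) ≡ ∑ D (λ S → z ^ length S)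
∑-sizeCount z K [] [] = ∑-zero (upTo (suc K))
∑-sizeCount z K (S ∷ D) (|S|≤K ∷ bounded) = begin
    ∑ ks (λ k → + sizeCount (S ∷ D) k ℤ.* z ^ k)
  ≡⟨ ∑-cong ks (λ k → trans (cong (ℤ._* z ^ k) (+length-filter-∷ (λ S → length S ℕ.≟ k) S D))
                            (ℤP.*-distribʳ-+ (z ^ k) (𝟙 (does (length S ℕ.≟ k))) (+ sizeCount D k))) ⟩
    ∑ ks (λ k → δ (length S) (z ^_) k + count k)
  ≡⟨ ∑-+ ks (δ (length S) (z ^_)) count ⟩
    ∑ ks (δ (length S) (z ^_)) + ∑ ks count
  ≡⟨ cong₂ _+_ (∑-δ (length S) (z ^_) ks (upTo⁺ (suc K)) (∈-upTo⁺ (s≤s |S|≤K)))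
               (∑-sizeCount z K D bounded) ⟩
    z ^ length S + ∑ D (λ S → z ^ length S)
  ∎
  where
  open ≡-Reasoning
  ks = upTo (suc K)
  count : ℕ → ℤ
  count k = + sizeCount D k ℤ.* z ^ k

module Covering {A U : Set} (R : A → U → Bool) where

  _⊕_ : (U → Bool) → A → U → Bool
  (c ⊕ a) u = c u ∨ R a u

  -- altSum Us L c = Σ_{S ⊆ L} (−1)^|S| [every u ∈ Us is covered by c or by S].
  altSum : List U → List A → (U → Bool) → ℤ
  altSum Us [] c = 𝟙 (all c Us)
  altSum Us (a ∷ L) c = altSum Us L c - altSum Us L (c ⊕ a)

  Agree : (U → Bool) → (U → Bool) → List U → Set
  Agree c c' Us = All (λ u → c u ≡ c' u) Us

  altSum-cong : ∀ {Us} L {c c'} → Agree c c' Us → altSum Us L c ≡ altSum Us L c'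
  altSum-cong [] eq = cong 𝟙 (all-cong eq)
  altSum-cong (a ∷ L) eq =
    cong₂ _-_ (altSum-cong L eq) (altSum-cong L (All.map (λ {u} e → cong (_∨ R a u) e) eq))

  altSum-swap : ∀ {Us} a b L c → altSum Us (a ∷ b ∷ L) c ≡ altSum Us (b ∷ a ∷ L) c
  altSum-swap {Us} a b L c = begin
      (Φ c - Φ (c ⊕ b)) - (Φ (c ⊕ a) - Φ ((c ⊕ a) ⊕ b))
    ≡⟨ cong (λ t → (Φ c - Φ (c ⊕ b)) - (Φ (c ⊕ a) - t))
            (altSum-cong L (All.universal (λ u → ∨-swap (c u) (R a u) (R b u)) Us)) ⟩
      (Φ c - Φ (c ⊕ b)) - (Φ (c ⊕ a) - Φ ((c ⊕ b) ⊕ a))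
    ≡⟨ exchange (Φ c) (Φ (c ⊕ b)) (Φ (c ⊕ a)) (Φ ((c ⊕ b) ⊕ a)) ⟩
      (Φ c - Φ (c ⊕ a)) - (Φ (c ⊕ b) - Φ ((c ⊕ b) ⊕ a))
    ∎
    where
    open ≡-Reasoning
    Φ : (U → Bool) → ℤ
    Φ = altSum Us L
    ∨-swap : ∀ x y z → (x ∨ y) ∨ z ≡ (x ∨ z) ∨ y
    ∨-swap x y z = trans (BoolP.∨-assoc x y z)
                   (trans (cong (x ∨_) (BoolP.∨-comm y z)) (sym (BoolP.∨-assoc x z y)))
    exchange : ∀ p q r s → (p - q) - (r - s) ≡ (p - r) - (q - s)
    exchange = solve-∀

  altSum-↭ : ∀ {Us L L'} → L ↭ L' → ∀ c → altSum Us L c ≡ altSum Us L' c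
  altSum-↭ ↭.refl c = refl
  altSum-↭ (↭.prep a p) c = cong₂ _-_ (altSum-↭ p c) (altSum-↭ p (c ⊕ a))
  altSum-↭ {L = a ∷ b ∷ L} (↭.swap a b p) c = trans (altSum-swap a b L c)
    (cong₂ _-_ (cong₂ _-_ (altSum-↭ p c) (altSum-↭ p (c ⊕ a)))
               (cong₂ _-_ (altSum-↭ p (c ⊕ b)) (altSum-↭ p ((c ⊕ b) ⊕ a))))
  altSum-↭ (↭.trans p q) c = trans (altSum-↭ p c) (altSum-↭ q c)

  covered : (U → Bool) → List A → U → Bool
  covered c S u = c u ∨ any (λ a → R a u) S

  altSum-sublists : ∀ Us L c →
    ∑ (sublists L) (λ S → -1ℤ ^ length S ℤ.* 𝟙 (all (covered c S) Us)) ≡ altSum Us L c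
  altSum-sublists Us [] c = begin
      1ℤ ℤ.* 𝟙 (all (covered c []) Us) + 0ℤ  ≡⟨ ℤP.+-identityʳ _ ⟩
      1ℤ ℤ.* 𝟙 (all (covered c []) Us)       ≡⟨ ℤP.*-identityˡ _ ⟩
      𝟙 (all (covered c []) Us)              ≡⟨ cong 𝟙 (all-cong (All.universal (BoolP.∨-identityʳ ∘ c) Us)) ⟩
      𝟙 (all c Us)                           ∎
    where open ≡-Reasoning
  altSum-sublists Us (a ∷ L) c = begin
      ∑ (map (a ∷_) (sublists L) ++ sublists L) (term c)
    ≡⟨ ∑-++ (map (a ∷_) (sublists L)) (sublists L) (term c) ⟩
      ∑ (map (a ∷_) (sublists L)) (term c) + ∑ (sublists L) (term c)
    ≡⟨ cong (_+ ∑ (sublists L) (term c)) (∑-map (a ∷_) (sublists L) (term c)) ⟩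
      ∑ (sublists L) (term c ∘ (a ∷_)) + ∑ (sublists L) (term c)
    ≡⟨ cong (_+ ∑ (sublists L) (term c)) (∑-cong (sublists L) term-∷) ⟩
      ∑ (sublists L) (λ S → - term (c ⊕ a) S) + ∑ (sublists L) (term c)
    ≡⟨ cong (_+ ∑ (sublists L) (term c)) (∑-neg (sublists L) (term (c ⊕ a))) ⟩
      - ∑ (sublists L) (term (c ⊕ a)) + ∑ (sublists L) (term c)
    ≡⟨ cong₂ (λ p q → - p + q) (altSum-sublists Us L (c ⊕ a)) (altSum-sublists Us L c) ⟩
      - altSum Us L (c ⊕ a) + altSum Us L c
    ≡⟨ ℤP.+-comm (- altSum Us L (c ⊕ a)) (altSum Us L c) ⟩
      altSum Us L c - altSum Us L (c ⊕ a)
    ∎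
    where
    open ≡-Reasoning
    term : (U → Bool) → List A → ℤ
    term c S = -1ℤ ^ length S ℤ.* 𝟙 (all (covered c S) Us)
    negate : ∀ p q → (-1ℤ ℤ.* p) ℤ.* q ≡ - (p ℤ.* q)
    negate = solve-∀
    term-∷ : ∀ S → term c (a ∷ S) ≡ - term (c ⊕ a) S
    term-∷ S = trans (negate (-1ℤ ^ length S) _)
      (cong (λ b → - (-1ℤ ^ length S ℤ.* 𝟙 b))
            (all-cong (All.universal (λ u → sym (BoolP.∨-assoc (c u) (R a u) _)) Us)))

  -- If N[a] ⊆ N[b] on the targets, the sets containing a are paired off by toggling b.
  altSum-absorb : ∀ {Us a b} L c → All (λ u → T (R a u) → T (R b u)) Us →
    altSum Us (b ∷ a ∷ L) c ≡ altSum Us (a ∷ L) c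
  altSum-absorb {Us} {a} {b} L c a⊆b = begin
      (Φ c - Φ (c ⊕ a)) - (Φ (c ⊕ b) - Φ ((c ⊕ b) ⊕ a))
    ≡⟨ cong (λ t → (Φ c - Φ (c ⊕ a)) - (Φ (c ⊕ b) - t))
            (altSum-cong L (All.map (λ {u} → ∨-absorb (c u)) a⊆b)) ⟩
      (Φ c - Φ (c ⊕ a)) - (Φ (c ⊕ b) - Φ (c ⊕ b))
    ≡⟨ cancel (Φ c - Φ (c ⊕ a)) (Φ (c ⊕ b)) ⟩
      Φ c - Φ (c ⊕ a)
    ∎
    where
    open ≡-Reasoning
    Φ : (U → Bool) → ℤ
    Φ = altSum Us L
    ∨-absorb : ∀ x {y z} → (T y → T z) → (x ∨ z) ∨ y ≡ x ∨ z
    ∨-absorb x {false} y⇒z = BoolP.∨-identityʳ (x ∨ _)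
    ∨-absorb x {true} {true} y⇒z = trans (BoolP.∨-zeroʳ (x ∨ true)) (sym (BoolP.∨-zeroʳ x))
    ∨-absorb x {true} {false} y⇒z = ⊥-elim (y⇒z _)
    cancel : ∀ p q → p - (q - q) ≡ p
    cancel = solve-∀

  altSum-dominated : {B : Set} (f g : B → A) {Us : List U} →
    (∀ y → All (λ u → T (R (f y) u) → T (R (g y) u)) Us) →
    ∀ Ys L c → altSum Us (map f Ys ++ map g Ys ++ L) c ≡ altSum Us (map f Ys ++ L) c
  altSum-dominated f g dom [] L c = refl
  altSum-dominated f g {Us} dom (y ∷ Ys) L c = begin
      altSum Us (f y ∷ map f Ys ++ g y ∷ M) c
    ≡⟨ altSum-↭ (↭.trans (↭.prep (f y) (shift (g y) (map f Ys) M)) (↭.swap (f y) (g y) ↭.refl)) c ⟩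
      altSum Us (g y ∷ f y ∷ map f Ys ++ M) c
    ≡⟨ altSum-absorb (map f Ys ++ M) c (dom y) ⟩
      altSum Us (f y ∷ map f Ys ++ M) c
    ≡⟨ cong₂ _-_ (altSum-dominated f g dom Ys L c) (altSum-dominated f g dom Ys L (c ⊕ f y)) ⟩
      altSum Us (f y ∷ map f Ys ++ L) c
    ∎
    where
    open ≡-Reasoning
    M = map g Ys ++ L

  altSum-dropTargets : (Inv : (U → Bool) → Set) {Us Us' : List U} →
    (∀ {c} → Inv c → all c Us ≡ all c Us') →
    ∀ L → All (λ a → ∀ {c} → Inv c → Inv (c ⊕ a)) L →
    ∀ {c} → Inv c → altSum Us L c ≡ altSum Us' L c
  altSum-dropTargets Inv same [] [] inv = cong 𝟙 (same inv)
  altSum-dropTargets Inv same (a ∷ L) (pres ∷ pres*) inv =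
    cong₂ _-_ (altSum-dropTargets Inv same L pres* inv)
              (altSum-dropTargets Inv same L pres* (pres inv))

  Apart : List A → List U → Set
  Apart L Us = All (λ a → All (λ u → R a u ≡ false) Us) L

  ⊕-apart : ∀ {a Us} c → All (λ u → R a u ≡ false) Us → Agree (c ⊕ a) c Us
  ⊕-apart c = All.map (λ {u} e → trans (cong (c u ∨_) e) (BoolP.∨-identityʳ (c u)))

  altSum-++ʳ : ∀ Us₁ Us₂ L c → Apart L Us₁ →
    altSum (Us₁ ++ Us₂) L c ≡ 𝟙 (all c Us₁) ℤ.* altSum Us₂ L c
  altSum-++ʳ Us₁ Us₂ [] c [] = trans (cong 𝟙 (all-++ c Us₁ Us₂)) (𝟙-∧ (all c Us₁) (all c Us₂))
  altSum-++ʳ Us₁ Us₂ (a ∷ L) c (a#Us₁ ∷ L#Us₁) = begin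
      altSum (Us₁ ++ Us₂) L c - altSum (Us₁ ++ Us₂) L (c ⊕ a)
    ≡⟨ cong₂ _-_ (altSum-++ʳ Us₁ Us₂ L c L#Us₁) (altSum-++ʳ Us₁ Us₂ L (c ⊕ a) L#Us₁) ⟩
      𝟙 (all c Us₁) ℤ.* altSum Us₂ L c - 𝟙 (all (c ⊕ a) Us₁) ℤ.* altSum Us₂ L (c ⊕ a)
    ≡⟨ cong (λ b → 𝟙 (all c Us₁) ℤ.* altSum Us₂ L c - 𝟙 b ℤ.* altSum Us₂ L (c ⊕ a))
            (all-cong (⊕-apart c a#Us₁)) ⟩
      𝟙 (all c Us₁) ℤ.* altSum Us₂ L c - 𝟙 (all c Us₁) ℤ.* altSum Us₂ L (c ⊕ a)
    ≡⟨ factorˡ (𝟙 (all c Us₁)) (altSum Us₂ L c) (altSum Us₂ L (c ⊕ a)) ⟩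
      𝟙 (all c Us₁) ℤ.* (altSum Us₂ L c - altSum Us₂ L (c ⊕ a))
    ∎
    where
    open ≡-Reasoning
    factorˡ : ∀ x p q → x ℤ.* p - x ℤ.* q ≡ x ℤ.* (p - q)
    factorˡ = solve-∀

  altSum-++ : ∀ Us₁ Us₂ L₁ L₂ c → Apart L₁ Us₂ → Apart L₂ Us₁ →
    altSum (Us₁ ++ Us₂) (L₁ ++ L₂) c ≡ altSum Us₁ L₁ c ℤ.* altSum Us₂ L₂ c
  altSum-++ Us₁ Us₂ [] L₂ c [] L₂#Us₁ = altSum-++ʳ Us₁ Us₂ L₂ c L₂#Us₁
  altSum-++ Us₁ Us₂ (a ∷ L₁) L₂ c (a#Us₂ ∷ L₁#Us₂) L₂#Us₁ = begin
      altSum (Us₁ ++ Us₂) (L₁ ++ L₂) c - altSum (Us₁ ++ Us₂) (L₁ ++ L₂) (c ⊕ a)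
    ≡⟨ cong₂ _-_ (altSum-++ Us₁ Us₂ L₁ L₂ c L₁#Us₂ L₂#Us₁)
                 (altSum-++ Us₁ Us₂ L₁ L₂ (c ⊕ a) L₁#Us₂ L₂#Us₁) ⟩
      altSum Us₁ L₁ c ℤ.* altSum Us₂ L₂ c - altSum Us₁ L₁ (c ⊕ a) ℤ.* altSum Us₂ L₂ (c ⊕ a)
    ≡⟨ cong (λ t → altSum Us₁ L₁ c ℤ.* altSum Us₂ L₂ c - altSum Us₁ L₁ (c ⊕ a) ℤ.* t)
            (altSum-cong L₂ (⊕-apart c a#Us₂)) ⟩
      altSum Us₁ L₁ c ℤ.* altSum Us₂ L₂ c - altSum Us₁ L₁ (c ⊕ a) ℤ.* altSum Us₂ L₂ c
    ≡⟨ factorʳ (altSum Us₂ L₂ c) (altSum Us₁ L₁ c) (altSum Us₁ L₁ (c ⊕ a)) ⟩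
      (altSum Us₁ L₁ c - altSum Us₁ L₁ (c ⊕ a)) ℤ.* altSum Us₂ L₂ c
    ∎
    where
    open ≡-Reasoning
    factorʳ : ∀ x p q → p ℤ.* x - q ℤ.* x ≡ (p - q) ℤ.* x
    factorʳ = solve-∀

altSum-relabel : {A U A' U' : Set} (R : A → U → Bool) (R' : A' → U' → Bool)
  (g : A → A') (h : U → U') →
  (∀ a u → R a u ≡ R' (g a) (h u)) →
  ∀ Us L {c : U → Bool} {c' : U' → Bool} → (∀ u → c u ≡ c' (h u)) →
  Covering.altSum R Us L c ≡ Covering.altSum R' (map h Us) (map g L) c'
altSum-relabel R R' g h eqR Us [] eqc = cong (𝟙 ∘ and) (trans (ListP.map-cong eqc Us) (ListP.map-∘ Us))
altSum-relabel R R' g h eqR Us (a ∷ L) eqc =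
  cong₂ _-_ (altSum-relabel R R' g h eqR Us L eqc)
            (altSum-relabel R R' g h eqR Us L (λ u → cong₂ _∨_ (eqc u) (eqR a u)))

near : ℕ → ℕ → Bool
near i j = dist i j ≤ᵇ 1

near-refl : ∀ k → near k k ≡ true
near-refl zero = refl
near-refl (suc k) = near-refl k

near-suc : ∀ k → T (near k (suc k))
near-suc zero = _
near-suc (suc k) = near-suc k

near-farʳ : ∀ {k j} → suc (suc k) ≤ j → near k j ≡ false
near-farʳ {zero} {suc zero} (s≤s ())
near-farʳ {zero} {suc (suc j)} _ = refl
near-farʳ {suc k} {suc j} (s≤s k+2≤j) = near-farʳ k+2≤j

near-farˡ : ∀ {k j} → suc (suc k) ≤ j → near j k ≡ false
near-farˡ {zero} {suc zero} (s≤s ())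
near-farˡ {zero} {suc (suc j)} _ = refl
near-farˡ {suc k} {suc j} (s≤s k+2≤j) = near-farˡ k+2≤j

near-stepˡ : ∀ {k j} → k ≤ j → T (near k j) → T (near (suc k) j)
near-stepˡ {zero} {zero} _ _ = _
near-stepˡ {zero} {suc zero} _ _ = _
near-stepˡ {suc k} {suc j} (s≤s k≤j) t = near-stepˡ k≤j t

rows : ℕ → ℕ → List ℕ
rows k zero = []
rows k (suc m) = k ∷ rows (suc k) m

rows-≥ : ∀ k m → All (k ≤_) (rows k m)
rows-≥ k zero = []
rows-≥ k (suc m) = ℕP.≤-refl ∷ All.map ℕP.<⇒≤ (rows-≥ (suc k) m)

module StrongProductWithPath {B : Set} (Q : B → B → Bool) (Ys : List B) where

  adj : ℕ × B → ℕ × B → Bool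
  adj (i , y) (j , y') = near i j ∧ Q y y'

  open Covering adj

  none : ℕ × B → Bool
  none _ = false

  row : ℕ → List (ℕ × B)
  row k = map (k ,_) Ys

  grid : ℕ → ℕ → List (ℕ × B)
  grid k m = cartesianProduct (rows k m) Ys

  gridSum : ℕ → ℕ → ℤ
  gridSum k m = altSum (grid k m) (grid k m) none

  rowSum : ℤ
  rowSum = Covering.altSum Q Ys Ys (λ _ → false)

  grid-All : ∀ {P : ℕ × B → Set} k m → (∀ {j} → k ≤ j → ∀ y → P (j , y)) → All P (grid k m)
  grid-All k m below = cartesianProduct⁺ (setoid ℕ) (setoid B) (rows k m) Ys
    (λ j∈rows _ → below (All.lookup (rows-≥ k m) j∈rows) _)

  row-altSum : ∀ k → altSum (row k) (row k) none ≡ rowSum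
  row-altSum k = sym (altSum-relabel Q adj (k ,_) (k ,_)
    (λ a u → sym (cong (_∧ Q a u) (near-refl k))) Ys Ys (λ _ → refl))

  Upward : ℕ → (ℕ × B → Bool) → Set
  Upward k c = ∀ y → T (c (k , y)) → T (c (suc k , y))

  upward-all : ∀ {k c} → Upward k c → T (all c (row k)) → T (all c (row (suc k)))
  upward-all {k} {c} up = go Ys
    where
    go : ∀ Zs → T (all c (map (k ,_) Zs)) → T (all c (map (suc k ,_) Zs))
    go [] _ = _
    go (z ∷ Zs) t = from BoolP.T-∧ (up z (proj₁ (to BoolP.T-∧ t)) , go Zs (proj₂ (to BoolP.T-∧ t)))

  upward-⊕ : ∀ {k j} y → (T (near j k) → T (near j (suc k))) → ∀ {c} → Upward k c → Upward k (c ⊕ (j , y))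
  upward-⊕ y near⇒ up y' = T-∨-mono (up y') (T-∧-monoˡ (Q y y') near⇒)

  gridSum-step : ∀ k m → gridSum k (2 ℕ.+ m) ≡ rowSum ℤ.* gridSum (2 ℕ.+ k) m
  gridSum-step k m = begin
      altSum (R₀ ++ R₁ ++ G) (R₀ ++ R₁ ++ G) none
    ≡⟨ altSum-dominated (k ,_) (suc k ,_) (λ y → grid-All k (2 ℕ.+ m) (dominated y)) Ys G none ⟩
      altSum (R₀ ++ R₁ ++ G) (R₀ ++ G) none
    ≡⟨ altSum-dropTargets (Upward k) same (R₀ ++ G) preserved (λ _ ()) ⟩
      altSum (R₀ ++ G) (R₀ ++ G) none
    ≡⟨ altSum-++ R₀ G R₀ G none R₀#G G#R₀ ⟩
      altSum R₀ R₀ none ℤ.* gridSum (2 ℕ.+ k) m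
    ≡⟨ cong (ℤ._* gridSum (2 ℕ.+ k) m) (row-altSum k) ⟩
      rowSum ℤ.* gridSum (2 ℕ.+ k) m
    ∎
    where
    open ≡-Reasoning
    R₀ = row k
    R₁ = row (suc k)
    G = grid (2 ℕ.+ k) m
    dominated : ∀ y {j} → k ≤ j → ∀ z → T (adj (k , y) (j , z)) → T (adj (suc k , y) (j , z))
    dominated y k≤j z = T-∧-monoˡ (Q y z) (near-stepˡ k≤j)
    same : ∀ {c} → Upward k c → all c (R₀ ++ R₁ ++ G) ≡ all c (R₀ ++ G)
    same {c} up = begin
        all c (R₀ ++ R₁ ++ G)            ≡⟨ all-++ c R₀ (R₁ ++ G) ⟩
        all c R₀ ∧ all c (R₁ ++ G)       ≡⟨ cong (all c R₀ ∧_) (all-++ c R₁ G) ⟩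
        all c R₀ ∧ (all c R₁ ∧ all c G)  ≡⟨ ∧-absorbˡ (all c R₀) (all c G) (upward-all up) ⟩
        all c R₀ ∧ all c G               ≡⟨ sym (all-++ c R₀ G) ⟩
        all c (R₀ ++ G)                  ∎
    vacuous : ∀ {j} → suc (suc k) ≤ j → T (near j k) → T (near j (suc k))
    vacuous k+2≤j t = ⊥-elim (subst T (near-farˡ k+2≤j) t)
    preserved : All (λ a → ∀ {c} → Upward k c → Upward k (c ⊕ a)) (R₀ ++ G)
    preserved = ++⁺ (map⁺ (All.universal (λ y {c} → upward-⊕ y (λ _ → near-suc k) {c}) Ys))
                    (grid-All (2 ℕ.+ k) m (λ k+2≤j y {c} → upward-⊕ y (vacuous k+2≤j) {c}))
    R₀#G : Apart R₀ G
    R₀#G = map⁺ (All.universal (λ y →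
             grid-All (2 ℕ.+ k) m (λ k+2≤j z → cong (_∧ Q y z) (near-farʳ k+2≤j))) Ys)
    G#R₀ : Apart G R₀
    G#R₀ = grid-All (2 ℕ.+ k) m (λ k+2≤j y →
             map⁺ (All.universal (λ z → cong (_∧ Q y z) (near-farˡ k+2≤j)) Ys))

  gridSum-pow : ∀ k m → gridSum k m ≡ rowSum ^ ⌈ m /2⌉
  gridSum-pow k zero = refl
  gridSum-pow k (suc zero) =
    trans (altSum-++ (row k) [] (row k) [] none (All.universal (λ _ → []) (row k)) [])
          (cong (ℤ._* 1ℤ) (row-altSum k))
  gridSum-pow k (suc (suc m)) = trans (gridSum-step k m) (cong (rowSum ℤ.*_) (gridSum-pow (2 ℕ.+ k) m))

map₁-cartesianProduct : {X X' Y : Set} (f : X → X') (xs : List X) (ys : List Y) →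
  map (map₁ f) (cartesianProduct xs ys) ≡ cartesianProduct (map f xs) ys
map₁-cartesianProduct f [] ys = refl
map₁-cartesianProduct f (x ∷ xs) ys =
  trans (ListP.map-++ (map₁ f) (map (x ,_) ys) _)
        (cong₂ _++_ (sym (ListP.map-∘ ys)) (map₁-cartesianProduct f xs ys))

cartesianProduct-[_] : {X Y : Set} (y : Y) (xs : List X) → cartesianProduct xs (y ∷ []) ≡ map (_, y) xs
cartesianProduct-[ y ] [] = refl
cartesianProduct-[ y ] (x ∷ xs) = cong ((x , y) ∷_) (cartesianProduct-[ y ] xs)

length-cartesianProduct : {X Y : Set} (xs : List X) (ys : List Y) →
  length (cartesianProduct xs ys) ≡ length xs * length ys
length-cartesianProduct [] ys = refl
length-cartesianProduct (x ∷ xs) ys =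
  trans (ListP.length-++ (map (x ,_) ys))
        (cong₂ ℕ._+_ (ListP.length-map (x ,_) ys) (length-cartesianProduct xs ys))

tabulate-rows : ∀ k m (f : Fin m → ℕ) → (∀ i → f i ≡ k ℕ.+ toℕ i) → tabulate f ≡ rows k m
tabulate-rows k zero f eq = refl
tabulate-rows k (suc m) f eq = cong₂ _∷_ (trans (eq Fin.zero) (ℕP.+-identityʳ k))
  (tabulate-rows (suc k) m (f ∘ Fin.suc) (λ i → trans (eq (Fin.suc i)) (ℕP.+-suc k (toℕ i))))

toℕ-allFin : ∀ m → map toℕ (allFin m) ≡ rows 0 m
toℕ-allFin m = trans (ListP.map-tabulate (λ i → i) toℕ) (tabulate-rows 0 m toℕ (λ _ → refl))

length-sublists : {X : Set} (L : List X) → All (λ S → length S ≤ length L) (sublists L)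
length-sublists [] = z≤n ∷ []
length-sublists (a ∷ L) =
  ++⁺ (map⁺ (All.map s≤s (length-sublists L))) (All.map ℕP.m≤n⇒m≤1+n (length-sublists L))

pathAdj : ∀ n → Fin n → Fin n → Bool
pathAdj n i j = near (toℕ i) (toℕ j)

path-altSum : ∀ n → Covering.altSum (pathAdj n) (allFin n) (allFin n) (λ _ → false) ≡ -1ℤ ^ ⌈ n /2⌉
path-altSum n = begin
    Covering.altSum (pathAdj n) (allFin n) (allFin n) (λ _ → false)
  ≡⟨ altSum-relabel (pathAdj n) Point.adj toPoint toPoint (λ _ _ → sym (BoolP.∧-identityʳ _))
                    (allFin n) (allFin n) (λ _ → refl) ⟩
    Covering.altSum Point.adj (map toPoint (allFin n)) (map toPoint (allFin n)) Point.none
  ≡⟨ cong (λ V → Covering.altSum Point.adj V V Point.none) points ⟩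
    Point.gridSum 0 n
  ≡⟨ Point.gridSum-pow 0 n ⟩
    -1ℤ ^ ⌈ n /2⌉
  ∎
  where
  open ≡-Reasoning
  module Point = StrongProductWithPath (λ _ _ → true) (tt ∷ [])
  toPoint : Fin n → ℕ × ⊤
  toPoint i = toℕ i , tt
  points : map toPoint (allFin n) ≡ Point.grid 0 n
  points = begin
      map toPoint (allFin n)                ≡⟨ ListP.map-∘ (allFin n) ⟩
      map (_, tt) (map toℕ (allFin n))      ≡⟨ cong (map (_, tt)) (toℕ-allFin n) ⟩
      map (_, tt) (rows 0 n)                ≡⟨ sym (cartesianProduct-[ tt ] (rows 0 n)) ⟩
      cartesianProduct (rows 0 n) (tt ∷ []) ∎

closedAdj : ∀ {m n} → Vertex m n → Vertex m n → Bool
closedAdj s v = ⌊ toℕ (proj₁ s) ℕ.≟ toℕ (proj₁ v) ⌋ ∧ ⌊ toℕ (proj₂ s) ℕ.≟ toℕ (proj₂ v) ⌋ ∨ adjacent s v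

≡ᵇ-dist : ∀ a b → (a ℕ.≡ᵇ b) ≡ (dist a b ℕ.≡ᵇ 0)
≡ᵇ-dist zero zero = refl
≡ᵇ-dist zero (suc b) = refl
≡ᵇ-dist (suc a) zero = refl
≡ᵇ-dist (suc a) (suc b) = ≡ᵇ-dist a b

both-zero-or-max-one : ∀ d e → ((d ℕ.≡ᵇ 0) ∧ (e ℕ.≡ᵇ 0)) ∨ (d ⊔ e ℕ.≡ᵇ 1) ≡ (d ≤ᵇ 1) ∧ (e ≤ᵇ 1)
both-zero-or-max-one zero zero = refl
both-zero-or-max-one zero (suc zero) = refl
both-zero-or-max-one zero (suc (suc e)) = refl
both-zero-or-max-one (suc zero) zero = refl
both-zero-or-max-one (suc zero) (suc zero) = refl
both-zero-or-max-one (suc zero) (suc (suc e)) = refl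
both-zero-or-max-one (suc (suc d)) zero = refl
both-zero-or-max-one (suc (suc d)) (suc zero) = refl
both-zero-or-max-one (suc (suc d)) (suc (suc e)) = refl

closedAdj-near : ∀ {m n} (s v : Vertex m n) →
  closedAdj s v ≡ near (toℕ (proj₁ s)) (toℕ (proj₁ v)) ∧ near (toℕ (proj₂ s)) (toℕ (proj₂ v))
closedAdj-near (x , y) (x' , y')
  rewrite isYes≗does (toℕ x ℕ.≟ toℕ x') | isYes≗does (toℕ y ℕ.≟ toℕ y')
        | isYes≗does (dist (toℕ x) (toℕ x') ⊔ dist (toℕ y) (toℕ y') ℕ.≟ 1)
        | ≡ᵇ-dist (toℕ x) (toℕ x') | ≡ᵇ-dist (toℕ y) (toℕ y')
  = both-zero-or-max-one (dist (toℕ x) (toℕ x')) (dist (toℕ y) (toℕ y'))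

king-altSum : ∀ m n →
  Covering.altSum closedAdj (vertices m n) (vertices m n) (λ _ → false) ≡ -1ℤ ^ (⌈ m /2⌉ * ⌈ n /2⌉)
king-altSum m n = begin
    Covering.altSum closedAdj V V (λ _ → false)
  ≡⟨ altSum-relabel closedAdj Rows.adj (map₁ toℕ) (map₁ toℕ) closedAdj-near V V (λ _ → refl) ⟩
    Covering.altSum Rows.adj (map (map₁ toℕ) V) (map (map₁ toℕ) V) Rows.none
  ≡⟨ cong (λ W → Covering.altSum Rows.adj W W Rows.none) cells ⟩
    Rows.gridSum 0 m
  ≡⟨ Rows.gridSum-pow 0 m ⟩
    Rows.rowSum ^ ⌈ m /2⌉
  ≡⟨ cong (_^ ⌈ m /2⌉) (path-altSum n) ⟩
    (-1ℤ ^ ⌈ n /2⌉) ^ ⌈ m /2⌉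
  ≡⟨ ℤP.^-*-assoc -1ℤ ⌈ n /2⌉ ⌈ m /2⌉ ⟩
    -1ℤ ^ (⌈ n /2⌉ * ⌈ m /2⌉)
  ≡⟨ cong (-1ℤ ^_) (ℕP.*-comm ⌈ n /2⌉ ⌈ m /2⌉) ⟩
    -1ℤ ^ (⌈ m /2⌉ * ⌈ n /2⌉)
  ∎
  where
  open ≡-Reasoning
  module Rows = StrongProductWithPath (pathAdj n) (allFin n)
  V = vertices m n
  cells : map (map₁ toℕ) V ≡ Rows.grid 0 m
  cells = trans (map₁-cartesianProduct toℕ (allFin m) (allFin n))
                (cong (λ xs → cartesianProduct xs (allFin n)) (toℕ-allFin m))

does-≟-true : ∀ b → does (b Bool.≟ true) ≡ b
does-≟-true true = refl
does-≟-true false = refl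

dominationPoly-altSum : ∀ m n →
  dominationPoly m n -1ℤ ≡ Covering.altSum closedAdj (vertices m n) (vertices m n) (λ _ → false)
dominationPoly-altSum m n = begin
    dominationPoly m n -1ℤ
  ≡⟨ ∑-sizeCount -1ℤ (m * n) (dominatingSets m n) small ⟩
    ∑ (dominatingSets m n) (λ S → -1ℤ ^ length S)
  ≡⟨ ∑-filter dominating? (sublists V) (λ S → -1ℤ ^ length S) ⟩
    ∑ (sublists V) (λ S → -1ℤ ^ length S ℤ.* 𝟙 (does (dominating? S)))
  ≡⟨ ∑-cong (sublists V) (λ S → cong (λ b → -1ℤ ^ length S ℤ.* 𝟙 b) (does-≟-true (isDominating m n S))) ⟩
    ∑ (sublists V) (λ S → -1ℤ ^ length S ℤ.* 𝟙 (isDominating m n S))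
  ≡⟨ Covering.altSum-sublists closedAdj V V (λ _ → false) ⟩
    Covering.altSum closedAdj V V (λ _ → false)
  ∎
  where
  open ≡-Reasoning
  V = vertices m n
  dominating? : Decidable (λ S → isDominating m n S ≡ true)
  dominating? S = isDominating m n S Bool.≟ true
  |V| : length V ≡ m * n
  |V| = trans (length-cartesianProduct (allFin m) (allFin n))
              (cong₂ _*_ (ListP.length-tabulate {n = m} (λ i → i)) (ListP.length-tabulate {n = n} (λ i → i)))
  small : All (λ S → length S ≤ m * n) (dominatingSets m n)
  small = filter⁺ dominating?
    (All.map (λ |S|≤|V| → ℕP.≤-trans |S|≤|V| (ℕP.≤-reflexive |V|)) (length-sublists V))

theorem1 : (m n : ℕ) → 1 ≤ m → 1 ≤ n →
    dominationPoly m n (- (+ 1)) ≡ (- (+ 1)) ^ (⌈ m /2⌉ * ⌈ n /2⌉)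
theorem1 m n _ _ = trans (dominationPoly-altSum m n) (king-altSum m n)
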